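{- Let $q\ge 2$, $n\ge1$, and let $f:Z_q^n\to\{0,1\}$ be a perfect $2$-coloring with matrix of parameters $\begin{pmatrix} n(q-1)-b & b\\ c & n(q-1)-c\end{pmatrix}$, i.e. every $x$ with $f(x)=0$ has exactly $b$ neighbors $y$ with $f(y)=1$, and every $x$ with $f(x)=1$ has exactly $c$ neighbors $y$ with $f(y)=0$. Then $\mathrm{cor}(f)=\frac{c+b}{q}-1$.
   Context: $Z_q=\{0,\dots,q-1\}$, $Z_q^n$ is the set of $n$-tuples over $Z_q$; $x,y$ are neighbors if they differ in exactly one coordinate (so each vertex has $n(q-1)$ neighbors). A perfect $2$-coloring is a function $f:Z_q^n\to\{0,1\}$ taking both values such that there are numbers $a_{ij}$ with every $x$ with $f(x)=i$ having exactly $a_{ij}$ neighbors $y$ with $f(y)=j$. An $m$-dimensional face is obtained by fixing $n-m$ chosen coordinates and letting the remaining $m$ range freely. $f$ is correlation-immune of order $k$ if every $(n-k)$-dimensional face contains the same number of points where $f=1$; $\mathrm{cor}(f)$ is the maximum such $k$. -}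

module Defs where

open import Data.Nat using (ℕ; zero; suc; _+_; _≤_)
open import Data.Fin using (Fin; zero; suc; _≟_)
open import Data.Fin.Subset using (Subset; ∣_∣)
open import Data.Bool using (Bool; true; false; _∧_; not; _∨_; if_then_else_)
open import Data.Vec using (Vec; []; _∷_)
open import Data.List using (List; map)
open import Data.Nat.ListAction using (sum)
open import Data.List using () renaming (allFin to allFinL)
open import Data.Product using (Σ; ∃; _×_)
open import Relation.Binary.PropositionalEquality using (_≡_)
open import Relation.Nullary.Decidable using (⌊_⌋)

Word : ℕ → ℕ → Set
Word q n = Vec (Fin q) n

countAll : (q n : ℕ) → (Word q n → Bool) → ℕ
countAll q zero    P = if P [] then 1 else 0
countAll q (suc n) P = sum (map (λ i → countAll q n (λ x → P (i ∷ x))) (allFinL q))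

dist : ∀ {q n} → Word q n → Word q n → ℕ
dist []       []       = 0
dist (a ∷ x) (b ∷ y) = (if ⌊ a ≟ b ⌋ then 0 else 1) + dist x y

adjacent : ∀ {q n} → Word q n → Word q n → Bool
adjacent x y = ⌊ Data.Nat._≟_ (dist x y) 1 ⌋
  where import Data.Nat

nbrCount : ∀ {q n} → (Word q n → Fin 2) → Word q n → Fin 2 → ℕ
nbrCount {q} {n} f x j = countAll q n (λ y → adjacent x y ∧ ⌊ f y ≟ j ⌋)

IsPerfect2Coloring : ∀ {q n} → (Word q n → Fin 2) → ℕ → ℕ → Set
IsPerfect2Coloring {q} {n} f b c =
  (∃ λ x → f x ≡ zero) × (∃ λ x → f x ≡ suc zero) ×
  (∀ x → f x ≡ zero → nbrCount f x (suc zero) ≡ b) ×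
  (∀ x → f x ≡ suc zero → nbrCount f x zero ≡ c)

-- x lies in the face obtained by fixing the coordinates in S to the values of v.
inFace : ∀ {q n} → Subset n → Word q n → Word q n → Bool
inFace []          []       []       = true
inFace (s ∷ S) (v ∷ vs) (x ∷ xs) = (not s ∨ ⌊ x ≟ v ⌋) ∧ inFace S vs xs

onesInFace : ∀ {q n} → (Word q n → Fin 2) → Subset n → Word q n → ℕ
onesInFace {q} {n} f S v = countAll q n (λ x → inFace S v x ∧ ⌊ f x ≟ suc zero ⌋)

CorrImmune : ∀ {q n} → (Word q n → Fin 2) → ℕ → Set
CorrImmune {q} {n} f k =
  k ≤ n ×
  (∀ (S S′ : Subset n) (v v′ : Word q n) → ∣ S ∣ ≡ k → ∣ S′ ∣ ≡ k →
     onesInFace f S v ≡ onesInFace f S′ v′)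

IsCor : ∀ {q n} → (Word q n → Fin 2) → ℕ → Set
IsCor f k = CorrImmune f k × (∀ k′ → CorrImmune f k′ → k′ ≤ k)

-- Write F(S, v) for the number of ones of f on the face that fixes the coordinates in S
-- to the values of v, and sum, over the points x of that face, the number of ones on the
-- n lines through x. A line along a coordinate i ∈ S sweeps out the face with i released,
-- while a line along a free coordinate stays in the face, so every point of the face is
-- met q times for each free coordinate. The perfect colouring condition makes the
-- per-point count the affine function b + (q n - b - c) f(x); hence for |S| = k + 1
--   Σ_{i ∈ S} F(S ∖ i, v) + (b + c) F(S, v) = b q^(n-k-1) + q (k + 1) F(S, v).
-- So if all faces with k fixed coordinates carry the same number of ones and
-- q (k + 1) ≠ b + c, then so do all faces with k + 1 fixed coordinates. This holds for
-- k = 0 and fails for k = n (f is not constant), so q (k + 1) = b + c for some k < n,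
-- f is correlation-immune of order k, and of no higher order: the induction from any
-- higher order would again reach n.
module Submission where

open import Defs
open import Data.Nat
  using (ℕ; zero; suc; _+_; _*_; _∸_; _^_; _≤_; _<_; _≤′_; ≤′-reflexive; ≤′-step; z≤n; z<s; NonZero; >-nonZero)
  renaming (_≟_ to _≟ℕ_)
open import Data.Nat.Properties hiding (_≟_)
open import Data.Fin using (Fin; zero; suc; _≟_; toℕ; fromℕ<)
open import Data.Fin.Properties using (any?; toℕ<n; toℕ-fromℕ<) renaming (suc-injective to fin-suc-injective)
open import Data.Fin.Subset using (Subset; ∣_∣; ⊤; ∁)
open import Data.Fin.Subset.Properties using (∣⊤∣≡n; ∣p∣≤n; ∣∁p∣≡n∸∣p∣)
open import Data.Bool using (Bool; true; false; _∧_; if_then_else_)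
open import Data.Vec using ([]; _∷_)
open import Data.List using (List; []; _∷_; map; length)
open import Data.List.Properties using (map-tabulate; length-tabulate; length-map)
open import Data.List.Relation.Unary.All using (All; []; _∷_)
import Data.List.Relation.Unary.All as All
import Data.List.Relation.Unary.All.Properties as All
open import Data.Nat.ListAction using (sum)
open import Data.List using () renaming (allFin to allFinL)
open import Data.Product using (Σ; ∃; _×_; _,_)
open import Data.Sum using (inj₁; inj₂)
open import Data.Empty using (⊥-elim)
open import Relation.Nullary using (¬_; yes; no)
open import Relation.Nullary.Decidable using (⌊_⌋)
open import Relation.Binary.PropositionalEquality
open import Function using (_∘_)
open import Algebra.Properties.CommutativeSemigroup +-commutativeSemigroup
  using (interchange; x∙yz≈y∙xz; xy∙z≈y∙xz; xy∙z≈xz∙y)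
open import Algebra.Properties.CommutativeSemigroup *-commutativeSemigroup
  using () renaming (x∙yz≈y∙xz to x*yz≡y*xz)

private variable
  A B : Set

𝟙 : Bool → ℕ
𝟙 b = if b then 1 else 0

sumOver : List A → (A → ℕ) → ℕ
sumOver xs h = sum (map h xs)

sumFin : (q : ℕ) → (Fin q → ℕ) → ℕ
sumFin q = sumOver (allFinL q)

sumOver-cong : (xs : List A) {h k : A → ℕ} → (∀ a → h a ≡ k a) → sumOver xs h ≡ sumOver xs k
sumOver-cong []       h≗k = refl
sumOver-cong (x ∷ xs) h≗k = cong₂ _+_ (h≗k x) (sumOver-cong xs h≗k)

sumOver-distrib-+ : (xs : List A) (h k : A → ℕ) →
  sumOver xs (λ a → h a + k a) ≡ sumOver xs h + sumOver xs k
sumOver-distrib-+ []       h k = refl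
sumOver-distrib-+ (x ∷ xs) h k = begin
  (h x + k x) + sumOver xs (λ a → h a + k a)   ≡⟨ cong ((h x + k x) +_) (sumOver-distrib-+ xs h k) ⟩
  (h x + k x) + (sumOver xs h + sumOver xs k)  ≡⟨ interchange (h x) (k x) _ _ ⟩
  (h x + sumOver xs h) + (k x + sumOver xs k)  ∎
  where open ≡-Reasoning

*-distribˡ-sumOver : (c : ℕ) (xs : List A) (h : A → ℕ) → c * sumOver xs h ≡ sumOver xs (λ a → c * h a)
*-distribˡ-sumOver c []       h = *-zeroʳ c
*-distribˡ-sumOver c (x ∷ xs) h =
  trans (*-distribˡ-+ c (h x) _) (cong (c * h x +_) (*-distribˡ-sumOver c xs h))

sumOver-const : (xs : List A) (c : ℕ) → sumOver xs (λ _ → c) ≡ length xs * c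
sumOver-const []       c = refl
sumOver-const (x ∷ xs) c = cong (c +_) (sumOver-const xs c)

sumOver-map : (xs : List B) (g : B → A) (h : A → ℕ) → sumOver (map g xs) h ≡ sumOver xs (λ b → h (g b))
sumOver-map []       g h = refl
sumOver-map (x ∷ xs) g h = cong (h (g x) +_) (sumOver-map xs g h)

sumOver-comm : (xs : List A) (ys : List B) (h : A → B → ℕ) →
  sumOver xs (λ a → sumOver ys (h a)) ≡ sumOver ys (λ b → sumOver xs (λ a → h a b))
sumOver-comm []       ys h = sym (trans (sumOver-const ys 0) (*-zeroʳ (length ys)))
sumOver-comm (x ∷ xs) ys h =
  trans (cong (sumOver ys (h x) +_) (sumOver-comm xs ys h))
        (sym (sumOver-distrib-+ ys (h x) (λ b → sumOver xs (λ a → h a b))))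

sumOver-cong-All : (P : A → Set) {xs ys : List A} {h k : A → ℕ} → length xs ≡ length ys →
  (∀ {a a′} → P a → P a′ → h a ≡ k a′) → All P xs → All P ys → sumOver xs h ≡ sumOver ys k
sumOver-cong-All P {[]}     {[]}     _   _   []         []         = refl
sumOver-cong-All P {x ∷ xs} {y ∷ ys} len h≈k (px ∷ pxs) (py ∷ pys) =
  cong₂ _+_ (h≈k px py) (sumOver-cong-All P (suc-injective len) h≈k pxs pys)

sumFin-suc : (q : ℕ) (h : Fin (suc q) → ℕ) → sumFin (suc q) h ≡ h zero + sumFin q (λ i → h (suc i))
sumFin-suc q h = cong (λ xs → h zero + sum xs)
  (trans (map-tabulate suc h) (sym (map-tabulate (λ i → i) (λ i → h (suc i)))))

sumFin-const : (q c : ℕ) → sumFin q (λ _ → c) ≡ q * c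
sumFin-const q c = trans (sumOver-const (allFinL q) c) (cong (_* c) (length-tabulate {n = q} (λ i → i)))

-- Stated with both sides moved so that no subtraction occurs.
sumFin-update : (q : ℕ) (h k : Fin q → ℕ) (v : Fin q) → (∀ i → i ≢ v → h i ≡ k i) →
  sumFin q h + k v ≡ h v + sumFin q k
sumFin-update (suc q) h k zero h≈k
  rewrite sumFin-suc q h | sumFin-suc q k
        | sumOver-cong (allFinL q) (λ i → h≈k (suc i) λ ())
  = trans (+-assoc (h zero) _ _) (cong (h zero +_) (+-comm _ (k zero)))
sumFin-update (suc q) h k (suc v) h≈k
  rewrite sumFin-suc q h | sumFin-suc q k | h≈k zero (λ ()) = begin
    (k zero + H) + k (suc v)  ≡⟨ +-assoc (k zero) H _ ⟩
    k zero + (H + k (suc v))  ≡⟨ cong (k zero +_) (sumFin-update q _ _ v h≈k-suc) ⟩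
    k zero + (h (suc v) + K)  ≡⟨ x∙yz≈y∙xz (k zero) (h (suc v)) K ⟩
    h (suc v) + (k zero + K)  ∎
  where
    open ≡-Reasoning
    H = sumFin q (λ i → h (suc i))
    K = sumFin q (λ i → k (suc i))
    h≈k-suc : ∀ i → i ≢ v → h (suc i) ≡ k (suc i)
    h≈k-suc i i≢v = h≈k (suc i) (i≢v ∘ fin-suc-injective)

sumFin-single : (q : ℕ) (h : Fin q → ℕ) (v : Fin q) → (∀ i → i ≢ v → h i ≡ 0) → sumFin q h ≡ h v
sumFin-single q h v h≈0 = begin
  sumFin q h                ≡⟨ +-identityʳ _ ⟨
  sumFin q h + 0            ≡⟨ sumFin-update q h (λ _ → 0) v h≈0 ⟩
  h v + sumFin q (λ _ → 0)  ≡⟨ cong (h v +_) (trans (sumFin-const q 0) (*-zeroʳ q)) ⟩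
  h v + 0                   ≡⟨ +-identityʳ _ ⟩
  h v                       ∎
  where open ≡-Reasoning

countAll-cong : ∀ q n {P Q : Word q n → Bool} → (∀ x → P x ≡ Q x) → countAll q n P ≡ countAll q n Q
countAll-cong q zero    P≗Q = cong 𝟙 (P≗Q [])
countAll-cong q (suc n) P≗Q = sumOver-cong (allFinL q) (λ i → countAll-cong q n (λ x → P≗Q (i ∷ x)))

countAll-false : ∀ q n → countAll q n (λ _ → false) ≡ 0
countAll-false q zero    = refl
countAll-false q (suc n) =
  trans (sumOver-cong (allFinL q) (λ i → countAll-false q n)) (trans (sumFin-const q 0) (*-zeroʳ q))

countAll-dist≡0 : ∀ q n (x : Word q n) (P : Word q n → Bool) →
  countAll q n (λ y → ⌊ dist x y ≟ℕ 0 ⌋ ∧ P y) ≡ 𝟙 (P x)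
countAll-dist≡0 q zero    []       P = refl
countAll-dist≡0 q (suc n) (a ∷ x) P =
  trans (sumFin-single q _ a off) (trans on (countAll-dist≡0 q n x (λ y → P (a ∷ y))))
  where
    off : ∀ i → i ≢ a → countAll q n (λ y → ⌊ dist (a ∷ x) (i ∷ y) ≟ℕ 0 ⌋ ∧ P (i ∷ y)) ≡ 0
    off i i≢a rewrite ≢-≟-identity _≟_ (i≢a ∘ sym) = countAll-false q n
    on : countAll q n (λ y → ⌊ dist (a ∷ x) (a ∷ y) ≟ℕ 0 ⌋ ∧ P (a ∷ y))
       ≡ countAll q n (λ y → ⌊ dist x y ≟ℕ 0 ⌋ ∧ P (a ∷ y))
    on rewrite ≡-≟-identity _≟_ {a} refl = refl

-- The sum of g over the n lines through x (so x itself is counted n times).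
lineSum : ∀ {q n} → (Word q n → ℕ) → Word q n → ℕ
lineSum     g []      = 0
lineSum {q} g (a ∷ x) = sumFin q (λ i → g (i ∷ x)) + lineSum (λ y → g (a ∷ y)) x

countAll-adjacent : ∀ q n (x : Word q n) (P : Word q n → Bool) →
  countAll q n (λ y → adjacent x y ∧ P y) + n * 𝟙 (P x) ≡ lineSum (λ y → 𝟙 (P y)) x
countAll-adjacent q zero    []      P = refl
countAll-adjacent q (suc n) (a ∷ x) P = begin
  sumFin q T + (β a + n * β a)    ≡⟨ +-assoc (sumFin q T) (β a) _ ⟨
  (sumFin q T + β a) + n * β a    ≡⟨ cong (_+ n * β a) (sumFin-update q T β a off) ⟩
  (T a + sumFin q β) + n * β a    ≡⟨ xy∙z≈y∙xz (T a) (sumFin q β) _ ⟩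
  sumFin q β + (T a + n * β a)    ≡⟨ cong (sumFin q β +_) (cong (_+ n * β a) on) ⟩
  sumFin q β + (countAll q n (λ y → adjacent x y ∧ P (a ∷ y)) + n * β a)
                                  ≡⟨ cong (sumFin q β +_) (countAll-adjacent q n x (λ y → P (a ∷ y))) ⟩
  sumFin q β + lineSum (λ y → 𝟙 (P (a ∷ y))) x  ∎
  where
    open ≡-Reasoning
    T : Fin q → ℕ
    T i = countAll q n (λ y → adjacent (a ∷ x) (i ∷ y) ∧ P (i ∷ y))
    β : Fin q → ℕ
    β i = 𝟙 (P (i ∷ x))
    suc≟1 : ∀ d → ⌊ suc d ≟ℕ 1 ⌋ ≡ ⌊ d ≟ℕ 0 ⌋
    suc≟1 zero    = refl
    suc≟1 (suc d) = refl
    off : ∀ i → i ≢ a → T i ≡ β i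
    off i i≢a rewrite ≢-≟-identity _≟_ (i≢a ∘ sym) =
      trans (countAll-cong q n (λ y → cong (_∧ P (i ∷ y)) (suc≟1 (dist x y))))
            (countAll-dist≡0 q n x (λ y → P (i ∷ y)))
    on : T a ≡ countAll q n (λ y → adjacent x y ∧ P (a ∷ y))
    on rewrite ≡-≟-identity _≟_ {a} refl = refl

lineSum-cong : ∀ {q n} (x : Word q n) {g h : Word q n → ℕ} → (∀ y → g y ≡ h y) → lineSum g x ≡ lineSum h x
lineSum-cong     []      g≗h = refl
lineSum-cong {q} (a ∷ x) g≗h =
  cong₂ _+_ (sumOver-cong (allFinL q) (λ i → g≗h (i ∷ x))) (lineSum-cong x (λ y → g≗h (a ∷ y)))

lineSum-+ : ∀ {q n} (x : Word q n) (g h : Word q n → ℕ) →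
  lineSum (λ y → g y + h y) x ≡ lineSum g x + lineSum h x
lineSum-+     []      g h = refl
lineSum-+ {q} (a ∷ x) g h =
  trans (cong₂ _+_ (sumOver-distrib-+ (allFinL q) (λ i → g (i ∷ x)) (λ i → h (i ∷ x)))
                   (lineSum-+ x (λ y → g (a ∷ y)) (λ y → h (a ∷ y))))
        (interchange (sumFin q (λ i → g (i ∷ x))) _ _ _)

lineSum-const : ∀ {q n} (x : Word q n) (c : ℕ) → lineSum (λ _ → c) x ≡ n * (q * c)
lineSum-const     []      c = refl
lineSum-const {q} (a ∷ x) c = cong₂ _+_ (sumFin-const q c) (lineSum-const x c)

faceSum : ∀ {q n} → (Word q n → ℕ) → Subset n → Word q n → ℕ
faceSum     g []          []      = g []
faceSum     g (true  ∷ S) (a ∷ v) = faceSum (λ x → g (a ∷ x)) S v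
faceSum {q} g (false ∷ S) (_ ∷ v) = sumFin q (λ i → faceSum (λ x → g (i ∷ x)) S v)

countAll-inFace : ∀ q n (S : Subset n) (v : Word q n) (P : Word q n → Bool) →
  countAll q n (λ x → inFace S v x ∧ P x) ≡ faceSum (λ x → 𝟙 (P x)) S v
countAll-inFace q zero    []          []      P = refl
countAll-inFace q (suc n) (false ∷ S) (a ∷ v) P =
  sumOver-cong (allFinL q) (λ i → countAll-inFace q n S v (λ x → P (i ∷ x)))
countAll-inFace q (suc n) (true ∷ S)  (a ∷ v) P =
  trans (sumFin-single q _ a off) (trans on (countAll-inFace q n S v (λ x → P (a ∷ x))))
  where
    off : ∀ i → i ≢ a → countAll q n (λ x → inFace (true ∷ S) (a ∷ v) (i ∷ x) ∧ P (i ∷ x)) ≡ 0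
    off i i≢a rewrite ≢-≟-identity _≟_ i≢a = countAll-false q n
    on : countAll q n (λ x → inFace (true ∷ S) (a ∷ v) (a ∷ x) ∧ P (a ∷ x))
       ≡ countAll q n (λ x → inFace S v x ∧ P (a ∷ x))
    on rewrite ≡-≟-identity _≟_ {a} refl = refl

faceSum-cong : ∀ {q n} (S : Subset n) (v : Word q n) {g h : Word q n → ℕ} →
  (∀ x → g x ≡ h x) → faceSum g S v ≡ faceSum h S v
faceSum-cong     []          []      g≗h = g≗h []
faceSum-cong     (true  ∷ S) (a ∷ v) g≗h = faceSum-cong S v (λ x → g≗h (a ∷ x))
faceSum-cong {q} (false ∷ S) (a ∷ v) g≗h =
  sumOver-cong (allFinL q) (λ i → faceSum-cong S v (λ x → g≗h (i ∷ x)))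

faceSum-+ : ∀ {q n} (S : Subset n) (v : Word q n) (g h : Word q n → ℕ) →
  faceSum (λ x → g x + h x) S v ≡ faceSum g S v + faceSum h S v
faceSum-+     []          []      g h = refl
faceSum-+     (true  ∷ S) (a ∷ v) g h = faceSum-+ S v (λ x → g (a ∷ x)) (λ x → h (a ∷ x))
faceSum-+ {q} (false ∷ S) (a ∷ v) g h =
  trans (sumOver-cong (allFinL q) (λ i → faceSum-+ S v (λ x → g (i ∷ x)) (λ x → h (i ∷ x))))
        (sumOver-distrib-+ (allFinL q) _ _)

*-distribˡ-faceSum : ∀ {q n} (c : ℕ) (S : Subset n) (v : Word q n) (g : Word q n → ℕ) →
  c * faceSum g S v ≡ faceSum (λ x → c * g x) S v
*-distribˡ-faceSum     c []          []      g = refl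
*-distribˡ-faceSum     c (true  ∷ S) (a ∷ v) g = *-distribˡ-faceSum c S v (λ x → g (a ∷ x))
*-distribˡ-faceSum {q} c (false ∷ S) (a ∷ v) g =
  trans (*-distribˡ-sumOver c (allFinL q) _)
        (sumOver-cong (allFinL q) (λ i → *-distribˡ-faceSum c S v (λ x → g (i ∷ x))))

faceSum-sumFin : ∀ {q n} (S : Subset n) (v : Word q n) (g : Fin q → Word q n → ℕ) →
  faceSum (λ x → sumFin q (λ i → g i x)) S v ≡ sumFin q (λ i → faceSum (g i) S v)
faceSum-sumFin     []          []      g = refl
faceSum-sumFin     (true  ∷ S) (a ∷ v) g = faceSum-sumFin S v (λ i x → g i (a ∷ x))
faceSum-sumFin {q} (false ∷ S) (a ∷ v) g =
  trans (sumOver-cong (allFinL q) (λ j → faceSum-sumFin S v (λ i x → g i (j ∷ x))))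
        (sumOver-comm (allFinL q) (allFinL q) (λ j i → faceSum (λ x → g i (j ∷ x)) S v))

faceSum-const : ∀ {q n} (S : Subset n) (v : Word q n) (c : ℕ) → faceSum (λ _ → c) S v ≡ c * q ^ ∣ ∁ S ∣
faceSum-const     []          []      c = sym (*-identityʳ c)
faceSum-const     (true  ∷ S) (a ∷ v) c = faceSum-const S v c
faceSum-const {q} (false ∷ S) (a ∷ v) c = begin
  sumFin q (λ _ → faceSum (λ _ → c) S v)  ≡⟨ sumOver-cong (allFinL q) (λ _ → faceSum-const S v c) ⟩
  sumFin q (λ _ → c * q ^ ∣ ∁ S ∣)        ≡⟨ sumFin-const q _ ⟩
  q * (c * q ^ ∣ ∁ S ∣)                  ≡⟨ x*yz≡y*xz q c _ ⟩
  c * (q * q ^ ∣ ∁ S ∣)                  ∎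
  where open ≡-Reasoning

faceSum-⊤ : ∀ {q n} (g : Word q n → ℕ) (v : Word q n) → faceSum g ⊤ v ≡ g v
faceSum-⊤ g []      = refl
faceSum-⊤ g (a ∷ v) = faceSum-⊤ (λ x → g (a ∷ x)) v

faceSum-unfixed : ∀ {q n} (g : Word q n → ℕ) (S S′ : Subset n) (v v′ : Word q n) →
  ∣ S ∣ ≡ 0 → ∣ S′ ∣ ≡ 0 → faceSum g S v ≡ faceSum g S′ v′
faceSum-unfixed     g []          []           []      []       _ _ = refl
faceSum-unfixed {q} g (false ∷ S) (false ∷ S′) (_ ∷ v) (_ ∷ v′) ∣S∣≡0 ∣S′∣≡0 =
  sumOver-cong (allFinL q) (λ i → faceSum-unfixed (λ x → g (i ∷ x)) S S′ v v′ ∣S∣≡0 ∣S′∣≡0)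

unfixOne : ∀ {n} → Subset n → List (Subset n)
unfixOne []          = []
unfixOne (true  ∷ S) = (false ∷ S) ∷ map (true ∷_) (unfixOne S)
unfixOne (false ∷ S) = map (false ∷_) (unfixOne S)

length-unfixOne : ∀ {n} (S : Subset n) → length (unfixOne S) ≡ ∣ S ∣
length-unfixOne []          = refl
length-unfixOne (true  ∷ S) = cong suc (trans (length-map (true ∷_) (unfixOne S)) (length-unfixOne S))
length-unfixOne (false ∷ S) = trans (length-map (false ∷_) (unfixOne S)) (length-unfixOne S)

unfixOne-∣∣ : ∀ {n} (S : Subset n) → All (λ T → suc ∣ T ∣ ≡ ∣ S ∣) (unfixOne S)
unfixOne-∣∣ []          = []
unfixOne-∣∣ (true  ∷ S) = refl ∷ All.map⁺ (All.map (cong suc) (unfixOne-∣∣ S))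
unfixOne-∣∣ (false ∷ S) = All.map⁺ (unfixOne-∣∣ S)

unfixSum : ∀ {q n} → (Word q n → ℕ) → Subset n → Word q n → ℕ
unfixSum g S v = sumOver (unfixOne S) (λ T → faceSum g T v)

unfixSum-true : ∀ {q n} (g : Word q (suc n) → ℕ) (S : Subset n) (a : Fin q) (v : Word q n) →
  unfixSum g (true ∷ S) (a ∷ v) ≡ faceSum g (false ∷ S) (a ∷ v) + unfixSum (λ x → g (a ∷ x)) S v
unfixSum-true g S a v =
  cong (faceSum g (false ∷ S) (a ∷ v) +_) (sumOver-map (unfixOne S) (true ∷_) (λ T → faceSum g T (a ∷ v)))

unfixSum-false : ∀ {q n} (g : Word q (suc n) → ℕ) (S : Subset n) (a : Fin q) (v : Word q n) →
  unfixSum g (false ∷ S) (a ∷ v) ≡ sumFin q (λ i → unfixSum (λ x → g (i ∷ x)) S v)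
unfixSum-false {q} g S a v =
  trans (sumOver-map (unfixOne S) (false ∷_) (λ T → faceSum g T (a ∷ v)))
        (sumOver-comm (unfixOne S) (allFinL q) (λ T i → faceSum (λ x → g (i ∷ x)) T v))

-- Double counting: a point of the face on a line through a released coordinate lies in a
-- face of unfixOne S; a line along a free coordinate stays inside the face.
faceSum-lineSum : ∀ {q n} (g : Word q n → ℕ) (S : Subset n) (v : Word q n) →
  faceSum (lineSum g) S v ≡ unfixSum g S v + ∣ ∁ S ∣ * q * faceSum g S v
faceSum-lineSum     g []          []      = refl
faceSum-lineSum {q} g (true ∷ S)  (a ∷ v) = begin
  faceSum (λ x → sumFin q (λ i → g (i ∷ x)) + lineSum gₐ x) S v
    ≡⟨ faceSum-+ S v _ (lineSum gₐ) ⟩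
  faceSum (λ x → sumFin q (λ i → g (i ∷ x))) S v + faceSum (lineSum gₐ) S v
    ≡⟨ cong₂ _+_ (faceSum-sumFin S v (λ i x → g (i ∷ x))) (faceSum-lineSum gₐ S v) ⟩
  faceSum g (false ∷ S) (a ∷ v) + (unfixSum gₐ S v + ∣ ∁ S ∣ * q * faceSum gₐ S v)
    ≡⟨ +-assoc (faceSum g (false ∷ S) (a ∷ v)) _ _ ⟨
  (faceSum g (false ∷ S) (a ∷ v) + unfixSum gₐ S v) + ∣ ∁ S ∣ * q * faceSum gₐ S v
    ≡⟨ cong (_+ ∣ ∁ S ∣ * q * faceSum gₐ S v) (unfixSum-true g S a v) ⟨
  unfixSum g (true ∷ S) (a ∷ v) + ∣ ∁ S ∣ * q * faceSum gₐ S v  ∎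
  where
    open ≡-Reasoning
    gₐ = λ x → g (a ∷ x)
faceSum-lineSum {q} g (false ∷ S) (a ∷ v) = begin
  sumFin q (λ i → faceSum (λ x → lineSum g (i ∷ x)) S v)
    ≡⟨ sumOver-cong (allFinL q) line-through ⟩
  sumFin q (λ i → Y + (U i + c * F i))
    ≡⟨ sumOver-distrib-+ (allFinL q) (λ _ → Y) _ ⟩
  sumFin q (λ _ → Y) + sumFin q (λ i → U i + c * F i)
    ≡⟨ cong₂ _+_ (sumFin-const q Y) (sumOver-distrib-+ (allFinL q) U _) ⟩
  q * Y + (sumFin q U + sumFin q (λ i → c * F i))
    ≡⟨ cong (λ z → q * Y + (sumFin q U + z)) (*-distribˡ-sumOver c (allFinL q) F) ⟨
  q * Y + (sumFin q U + c * Y)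
    ≡⟨ x∙yz≈y∙xz (q * Y) (sumFin q U) (c * Y) ⟩
  sumFin q U + (q * Y + c * Y)
    ≡⟨ cong₂ _+_ (unfixSum-false g S a v) (*-distribʳ-+ Y q c) ⟨
  unfixSum g (false ∷ S) (a ∷ v) + suc ∣ ∁ S ∣ * q * Y  ∎
  where
    open ≡-Reasoning
    c = ∣ ∁ S ∣ * q
    F U : Fin q → ℕ
    F i = faceSum (λ x → g (i ∷ x)) S v
    U i = unfixSum (λ x → g (i ∷ x)) S v
    Y = faceSum g (false ∷ S) (a ∷ v)
    line-through : ∀ i → faceSum (λ x → lineSum g (i ∷ x)) S v ≡ Y + (U i + c * F i)
    line-through i = trans (faceSum-+ S v _ _)
      (cong₂ _+_ (faceSum-sumFin S v (λ j x → g (j ∷ x))) (faceSum-lineSum (λ x → g (i ∷ x)) S v))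

private
  slopes-agree : ∀ D B m Q x d → D + m * x ≡ B + Q * x → D + m * (x + d) ≡ B + Q * (x + d) → m * d ≡ Q * d
  slopes-agree D B m Q x d eqˣ eqˣ⁺ᵈ = +-cancelˡ-≡ (D + m * x) _ _ (begin
    D + m * x + m * d    ≡⟨ +-assoc D _ _ ⟩
    D + (m * x + m * d)  ≡⟨ cong (D +_) (*-distribˡ-+ m x d) ⟨
    D + m * (x + d)      ≡⟨ eqˣ⁺ᵈ ⟩
    B + Q * (x + d)      ≡⟨ cong (B +_) (*-distribˡ-+ Q x d) ⟩
    B + (Q * x + Q * d)  ≡⟨ +-assoc B _ _ ⟨
    B + Q * x + Q * d    ≡⟨ cong (_+ Q * d) eqˣ ⟨
    D + m * x + Q * d    ∎)
    where open ≡-Reasoning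

  affine-injective-≤ : ∀ {D B m Q x y} → m ≢ Q → x ≤ y →
    D + m * x ≡ B + Q * x → D + m * y ≡ B + Q * y → x ≡ y
  affine-injective-≤ {D} {B} {m} {Q} {x} m≢Q x≤y eqˣ eqʸ with m≤n⇒∃[o]m+o≡n x≤y
  ... | zero  , refl = sym (+-identityʳ x)
  ... | suc d , refl = ⊥-elim (m≢Q (*-cancelʳ-≡ m Q (suc d) (slopes-agree D B m Q x (suc d) eqˣ eqʸ)))

affine-injective : ∀ {D B m Q x y} → m ≢ Q → D + m * x ≡ B + Q * x → D + m * y ≡ B + Q * y → x ≡ y
affine-injective {x = x} {y} m≢Q eqˣ eqʸ with ≤-total x y
... | inj₁ x≤y = affine-injective-≤ m≢Q x≤y eqˣ eqʸ
... | inj₂ y≤x = sym (affine-injective-≤ m≢Q y≤x eqʸ eqˣ)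

∣S∣+∣∁S∣≡n : ∀ {n} (S : Subset n) → ∣ S ∣ + ∣ ∁ S ∣ ≡ n
∣S∣+∣∁S∣≡n S = trans (cong (∣ S ∣ +_) (∣∁p∣≡n∸∣p∣ S)) (m+[n∸m]≡n (∣p∣≤n S))

module Colouring {q n : ℕ} (f : Word q n → Fin 2) {b c : ℕ}
  (zero-nbrs : ∀ x → f x ≡ zero → nbrCount f x (suc zero) ≡ b)
  (one-nbrs  : ∀ x → f x ≡ suc zero → nbrCount f x zero ≡ c) where

  ones zeros : Word q n → ℕ
  ones  x = 𝟙 ⌊ f x ≟ suc zero ⌋
  zeros x = 𝟙 ⌊ f x ≟ zero ⌋

  zeros+ones≡1 : ∀ x → zeros x + ones x ≡ 1
  zeros+ones≡1 x with f x
  ... | zero     = refl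
  ... | suc zero = refl

  lineSum-ones-at-zero : ∀ x → f x ≡ zero → lineSum ones x ≡ b
  lineSum-ones-at-zero x fx≡0 = begin
    lineSum ones x                        ≡⟨ countAll-adjacent q n x (λ y → ⌊ f y ≟ suc zero ⌋) ⟨
    nbrCount f x (suc zero) + n * ones x  ≡⟨ cong₂ _+_ (zero-nbrs x fx≡0)
                                                        (cong (λ i → n * 𝟙 ⌊ i ≟ suc zero ⌋) fx≡0) ⟩
    b + n * 0                             ≡⟨ cong (b +_) (*-zeroʳ n) ⟩
    b + 0                                 ≡⟨ +-identityʳ b ⟩
    b                                     ∎
    where open ≡-Reasoning

  lineSum-ones-at-one : ∀ x → f x ≡ suc zero → c + lineSum ones x ≡ n * q
  lineSum-ones-at-one x fx≡1 = begin
    c + lineSum ones x                  ≡⟨ cong (_+ lineSum ones x) lineSum-zeros ⟨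
    lineSum zeros x + lineSum ones x    ≡⟨ lineSum-+ x zeros ones ⟨
    lineSum (λ y → zeros y + ones y) x  ≡⟨ lineSum-cong x zeros+ones≡1 ⟩
    lineSum (λ _ → 1) x                 ≡⟨ lineSum-const x 1 ⟩
    n * (q * 1)                         ≡⟨ cong (n *_) (*-identityʳ q) ⟩
    n * q                               ∎
    where
      open ≡-Reasoning
      lineSum-zeros : lineSum zeros x ≡ c
      lineSum-zeros = begin
        lineSum zeros x                   ≡⟨ countAll-adjacent q n x (λ y → ⌊ f y ≟ zero ⌋) ⟨
        nbrCount f x zero + n * zeros x   ≡⟨ cong₂ _+_ (one-nbrs x fx≡1)
                                                         (cong (λ i → n * 𝟙 ⌊ i ≟ zero ⌋) fx≡1) ⟩
        c + n * 0                         ≡⟨ cong (c +_) (*-zeroʳ n) ⟩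
        c + 0                             ≡⟨ +-identityʳ c ⟩
        c                                 ∎

  lineSum-ones : ∀ x → lineSum ones x + (c + b) * ones x ≡ b + n * q * ones x
  lineSum-ones x with f x in fx
  ... | zero     = begin
    lineSum ones x + (c + b) * 0  ≡⟨ cong₂ _+_ (lineSum-ones-at-zero x fx) (*-zeroʳ (c + b)) ⟩
    b + 0                         ≡⟨ cong (b +_) (*-zeroʳ (n * q)) ⟨
    b + n * q * 0                 ∎
    where open ≡-Reasoning
  ... | suc zero = begin
    lineSum ones x + (c + b) * 1  ≡⟨ cong (lineSum ones x +_) (*-identityʳ (c + b)) ⟩
    lineSum ones x + (c + b)      ≡⟨ x∙yz≈y∙xz (lineSum ones x) c b ⟩
    c + (lineSum ones x + b)      ≡⟨ +-assoc c _ b ⟨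
    c + lineSum ones x + b        ≡⟨ cong (_+ b) (lineSum-ones-at-one x fx) ⟩
    n * q + b                     ≡⟨ +-comm (n * q) b ⟩
    b + n * q                     ≡⟨ cong (b +_) (*-identityʳ (n * q)) ⟨
    b + n * q * 1                 ∎
    where open ≡-Reasoning

  F : Subset n → Word q n → ℕ
  F = faceSum ones

  onesInFace≡F : ∀ S v → onesInFace f S v ≡ F S v
  onesInFace≡F S v = countAll-inFace q n S v (λ x → ⌊ f x ≟ suc zero ⌋)

  faceEquation : ∀ S v → unfixSum ones S v + (c + b) * F S v ≡ b * q ^ (n ∸ ∣ S ∣) + ∣ S ∣ * q * F S v
  faceEquation S v = +-cancelʳ-≡ (∣ ∁ S ∣ * q * F S v) _ _ (begin
    unfixSum ones S v + (c + b) * F S v + ∣ ∁ S ∣ * q * F S v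
      ≡⟨ xy∙z≈xz∙y (unfixSum ones S v) _ _ ⟩
    unfixSum ones S v + ∣ ∁ S ∣ * q * F S v + (c + b) * F S v
      ≡⟨ cong₂ _+_ (sym (faceSum-lineSum ones S v)) (*-distribˡ-faceSum (c + b) S v ones) ⟩
    faceSum (lineSum ones) S v + faceSum (λ x → (c + b) * ones x) S v
      ≡⟨ faceSum-+ S v (lineSum ones) _ ⟨
    faceSum (λ x → lineSum ones x + (c + b) * ones x) S v
      ≡⟨ faceSum-cong S v lineSum-ones ⟩
    faceSum (λ x → b + n * q * ones x) S v
      ≡⟨ faceSum-+ S v (λ _ → b) _ ⟩
    faceSum (λ _ → b) S v + faceSum (λ x → n * q * ones x) S v
      ≡⟨ cong₂ _+_ (faceSum-const S v b) (sym (*-distribˡ-faceSum (n * q) S v ones)) ⟩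
    b * q ^ ∣ ∁ S ∣ + n * q * F S v
      ≡⟨ cong (λ m → b * q ^ ∣ ∁ S ∣ + m * q * F S v) (∣S∣+∣∁S∣≡n S) ⟨
    b * q ^ ∣ ∁ S ∣ + (∣ S ∣ + ∣ ∁ S ∣) * q * F S v
      ≡⟨ cong (λ e → b * q ^ e + (∣ S ∣ + ∣ ∁ S ∣) * q * F S v) (∣∁p∣≡n∸∣p∣ S) ⟩
    b * q ^ (n ∸ ∣ S ∣) + (∣ S ∣ + ∣ ∁ S ∣) * q * F S v
      ≡⟨ cong (b * q ^ (n ∸ ∣ S ∣) +_) (slope-+ ∣ S ∣ ∣ ∁ S ∣) ⟩
    b * q ^ (n ∸ ∣ S ∣) + (∣ S ∣ * q * F S v + ∣ ∁ S ∣ * q * F S v)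
      ≡⟨ +-assoc (b * q ^ (n ∸ ∣ S ∣)) _ _ ⟨
    b * q ^ (n ∸ ∣ S ∣) + ∣ S ∣ * q * F S v + ∣ ∁ S ∣ * q * F S v  ∎)
    where
      open ≡-Reasoning
      slope-+ : ∀ s t → (s + t) * q * F S v ≡ s * q * F S v + t * q * F S v
      slope-+ s t = trans (cong (_* F S v) (*-distribʳ-+ q s t)) (*-distribʳ-+ (F S v) (s * q) (t * q))

  Balanced : ℕ → Set
  Balanced k = ∀ (S S′ : Subset n) (v v′ : Word q n) →
    ∣ S ∣ ≡ k → ∣ S′ ∣ ≡ k → F S v ≡ F S′ v′

  corrImmune : ∀ {k} → k ≤ n → Balanced k → CorrImmune f k
  corrImmune k≤n bal = k≤n , λ S S′ v v′ ∣S∣≡k ∣S′∣≡k →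
    trans (onesInFace≡F S v) (trans (bal S S′ v v′ ∣S∣≡k ∣S′∣≡k) (sym (onesInFace≡F S′ v′)))

  balanced : ∀ {k} → CorrImmune f k → Balanced k
  balanced (_ , immune) S S′ v v′ ∣S∣≡k ∣S′∣≡k =
    trans (sym (onesInFace≡F S v)) (trans (immune S S′ v v′ ∣S∣≡k ∣S′∣≡k) (onesInFace≡F S′ v′))

  balanced-zero : Balanced 0
  balanced-zero = faceSum-unfixed ones

  ¬balanced-n : ∀ {x₀ x₁} → f x₀ ≡ zero → f x₁ ≡ suc zero → ¬ Balanced n
  ¬balanced-n {x₀} {x₁} fx₀≡0 fx₁≡1 bal = 0≢1+n (begin
    0         ≡⟨ cong (λ i → 𝟙 ⌊ i ≟ suc zero ⌋) fx₀≡0 ⟨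
    ones x₀   ≡⟨ faceSum-⊤ ones x₀ ⟨
    F ⊤ x₀    ≡⟨ bal ⊤ ⊤ x₀ x₁ (∣⊤∣≡n n) (∣⊤∣≡n n) ⟩
    F ⊤ x₁    ≡⟨ faceSum-⊤ ones x₁ ⟩
    ones x₁   ≡⟨ cong (λ i → 𝟙 ⌊ i ≟ suc zero ⌋) fx₁≡1 ⟩
    1         ∎)
    where open ≡-Reasoning

  -- Faces with k + 1 fixed coordinates satisfy faceEquation with the same intercept, since
  -- each unfixSum adds up k + 1 faces with k fixed coordinates; the slopes differ.
  balanced-suc : ∀ {k} → suc k * q ≢ c + b → Balanced k → Balanced (suc k)
  balanced-suc {k} noRoot bal S S′ v v′ ∣S∣≡1+k ∣S′∣≡1+k =
    affine-injective (noRoot ∘ sym) (equation S v ∣S∣≡1+k)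
      (subst (λ D → D + (c + b) * F S′ v′ ≡ _) same-unfixSum (equation S′ v′ ∣S′∣≡1+k))
    where
      equation : ∀ T w → ∣ T ∣ ≡ suc k →
        unfixSum ones T w + (c + b) * F T w ≡ b * q ^ (n ∸ suc k) + suc k * q * F T w
      equation T w ∣T∣≡1+k =
        subst (λ j → unfixSum ones T w + (c + b) * F T w ≡ b * q ^ (n ∸ j) + j * q * F T w)
              ∣T∣≡1+k (faceEquation T w)
      unfixOne-∣∣≡k : ∀ T → ∣ T ∣ ≡ suc k → All (λ U → ∣ U ∣ ≡ k) (unfixOne T)
      unfixOne-∣∣≡k T ∣T∣≡1+k = All.map (λ e → suc-injective (trans e ∣T∣≡1+k)) (unfixOne-∣∣ T)
      same-unfixSum : unfixSum ones S′ v′ ≡ unfixSum ones S v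
      same-unfixSum = sumOver-cong-All (λ U → ∣ U ∣ ≡ k)
        (trans (length-unfixOne S′) (trans ∣S′∣≡1+k (sym (trans (length-unfixOne S) ∣S∣≡1+k))))
        (λ {U} {U′} → bal U U′ v′ v)
        (unfixOne-∣∣≡k S′ ∣S′∣≡1+k) (unfixOne-∣∣≡k S ∣S∣≡1+k)

  balanced-lift : ∀ {j k} → j ≤′ k → (∀ t → j ≤ t → t < k → suc t * q ≢ c + b) →
    Balanced j → Balanced k
  balanced-lift (≤′-reflexive refl) _      bal = bal
  balanced-lift (≤′-step {k} j≤′k)  noRoot bal =
    balanced-suc (noRoot k (≤′⇒≤ j≤′k) ≤-refl)
      (balanced-lift j≤′k (λ t j≤t t<k → noRoot t j≤t (m<n⇒m<1+n t<k)) bal)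

  root-exists : ¬ Balanced n → ∃ λ k → k < n × suc k * q ≡ c + b
  root-exists ¬bal with any? (λ (i : Fin n) → suc (toℕ i) * q ≟ℕ c + b)
  ... | yes (i , root) = toℕ i , toℕ<n i , root
  ... | no  noRoot     = ⊥-elim (¬bal (balanced-lift (≤⇒≤′ z≤n) noRoot<n balanced-zero))
    where
      noRoot<n : ∀ t → 0 ≤ t → t < n → suc t * q ≢ c + b
      noRoot<n t _ t<n root =
        noRoot (fromℕ< t<n , subst (λ s → suc s * q ≡ c + b) (sym (toℕ-fromℕ< t<n)) root)

  isCor-root : .{{NonZero q}} → ¬ Balanced n → ∀ {k} → k < n → suc k * q ≡ c + b → IsCor f k
  isCor-root ¬bal {k} k<n root =
      corrImmune (<⇒≤ k<n) (balanced-lift (≤⇒≤′ z≤n) (λ t _ t<k → other-root (<⇒≢ t<k)) balanced-zero)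
    , maximal
    where
      other-root : ∀ {t} → t ≢ k → suc t * q ≢ c + b
      other-root t≢k root′ = t≢k (suc-injective (*-cancelʳ-≡ _ _ q (trans root′ (sym root))))
      maximal : ∀ k′ → CorrImmune f k′ → k′ ≤ k
      maximal k′ immune@(k′≤n , _) with k′ ≤? k
      ... | yes k′≤k = k′≤k
      ... | no  k′≰k = ⊥-elim (¬bal (balanced-lift (≤⇒≤′ k′≤n)
              (λ t k′≤t _ → other-root (>⇒≢ (<-≤-trans (≰⇒> k′≰k) k′≤t))) (balanced immune)))

-- The hypothesis 1 ≤ n is not needed: f takes both values.
corollary1 : (q n : ℕ) → 2 ≤ q → 1 ≤ n → (f : Word q n → Fin 2) → (b c : ℕ) →
    IsPerfect2Coloring f b c →
    Σ ℕ (λ k → IsCor f k × q * suc k ≡ c + b)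
corollary1 q n 2≤q _ f b c ((_ , fx₀≡0) , (_ , fx₁≡1) , zero-nbrs , one-nbrs) =
  let (k , k<n , root) = root-exists ¬bal in
  k , isCor-root ¬bal k<n root , trans (*-comm q (suc k)) root
  where
    open Colouring f zero-nbrs one-nbrs
    instance
      q≢0 : NonZero q
      q≢0 = >-nonZero (<-≤-trans z<s 2≤q)
    ¬bal : ¬ Balanced n
    ¬bal = ¬balanced-n fx₀≡0 fx₁≡1
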